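{- For a gehm $\mathbb{H}$, \[T(\mathbb{H};x+1,y+1)=\sqrt{x}^{\,d(\mathbb{H})-e(\mathbb{H})-f(\mathbb{H})}\sqrt{y}^{\,-v(\mathbb{H})}\,Z\Big(\mathbb{H};\frac{\sqrt y}{\sqrt x},\sqrt x\sqrt y\Big).\]
   Context: A gehm is a finite cubic graph whose edges are properly coloured with colours $b,g,r$, together with possibly some isolates ($g$-coloured edges meeting no vertex). Hyperedges are $b$--$r$-cycles, hyperfaces are $b$--$g$-cycles or isolates, hypervertices are $g$--$r$-cycles or isolates. $E(\mathbb{H})$, $e(\mathbb{H})$, $v(\mathbb{H})$, $f(\mathbb{H})$: set of hyperedges and numbers of hyperedges, hypervertices, hyperfaces; $k(\mathbb{H})$: number of components (isolates count); $d(e)$: half the number of gehm-edges in hyperedge $e$, $d(A)=\sum_{e\in A}d(e)$, $d(\mathbb{H})=d(E(\mathbb{H}))$; $\gamma(\mathbb{H})=2k(\mathbb{H})-v(\mathbb{H})-e(\mathbb{H})+d(\mathbb{H})-f(\mathbb{H})$. Suppressing a degree-two vertex: if its only edge is a loop, replace it and the loop by an isolate; otherwise contract one incident edge. Deleting a hyperedge $e$: delete its $b$-edges, contract its $r$-edges, suppress degree-two vertices. For $A\subseteq E(\mathbb{H})$, $\mathbb{H}_{|A}$ is obtained by deleting all hyperedges not in $A$; $v(A),k(A),f(A),\gamma(A)$ are the quantities of $\mathbb{H}_{|A}$. $\rho(\mathbb{H})=v(\mathbb{H})-k(\mathbb{H})+\tfrac12\gamma(\mathbb{H})$, $\rho(A)=v(A)-k(A)+\tfrac12\gamma(A)$.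 $T(\mathbb{H};x,y)=\sum_{A\subseteq E(\mathbb{H})}(x-1)^{\rho(\mathbb{H})-\rho(A)}(y-1)^{d(A)-|A|-\rho(A)}$ and $Z(\mathbb{H};u,v)=\sum_{A\subseteq E(\mathbb{H})}u^{d(A)-|A|}v^{f(A)}$. -}

module Defs where

open import Level using (Level)
open import Data.Bool using (Bool; true; false; not; _∧_; _∨_; if_then_else_)
open import Data.Nat as ℕ using (ℕ; zero; suc; _/_; _≤ᵇ_)
open import Data.Nat.ListAction using (sum)
open import Data.Bool.ListAction using (all; any)
open import Data.Integer as ℤ using (ℤ; +_; -[1+_])
open import Data.Fin using (Fin; zero; suc; toℕ; _≟_)
open import Data.List using (List; []; _∷_; map; foldr; allFin; filterᵇ; concatMap)
open import Relation.Nullary.Decidable using (⌊_⌋)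
open import Relation.Binary.PropositionalEquality using (_≡_; _≢_)
open import Algebra.Bundles using (CommutativeRing)

-- A gehm is encoded by its vertex set Fin n and, for each colour
-- c ∈ {b,g,r}, the fixed-point-free involution sending a vertex to the
-- other end of its (unique) c-coloured edge.  This is exactly a finite
-- cubic graph (multi-edges allowed, no loops since the colouring is
-- proper) with a proper 3-edge-colouring.

record Gehm : Set where
  field
    n       : ℕ
    b g r   : Fin n → Fin n
    b-invol : ∀ v → b (b v) ≡ v
    g-invol : ∀ v → g (g v) ≡ v
    r-invol : ∀ v → r (r v) ≡ v
    b-fpf   : ∀ v → b v ≢ v
    g-fpf   : ∀ v → g v ≢ v
    r-fpf   : ∀ v → r v ≢ v
    isolates : ℕ

VSet : ℕ → Set
VSet n = Fin n → Bool

count : ∀ {n} → VSet n → ℕ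
count {n} X = sum (map (λ v → if X v then 1 else 0) (allFin n))

_⊆ᵇ_ : ∀ {n} → VSet n → VSet n → Bool
_⊆ᵇ_ {n} X Y = all (λ w → not (X w) ∨ Y w) (allFin n)

closeStep : ∀ {n} → List (Fin n → Fin n) → VSet n → VSet n
closeStep {n} fs X w =
  X w ∨ any (λ u → X u ∧ any (λ f → ⌊ f u ≟ w ⌋) fs) (allFin n)

iterate : ∀ {A : Set} → ℕ → (A → A) → A → A
iterate zero    h a = a
iterate (suc k) h a = h (iterate k h a)

-- orbit of v under the group generated by the (involutions) fs:
-- n closure steps reach every vertex reachable from v.
orbit : ∀ {n} → List (Fin n → Fin n) → Fin n → VSet n
orbit {n} fs v = iterate n (closeStep fs) (λ w → ⌊ w ≟ v ⌋)

isRep : ∀ {n} → List (Fin n → Fin n) → Fin n → Bool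
isRep {n} fs v = all (λ w → not (orbit fs v w) ∨ (toℕ v ≤ᵇ toℕ w)) (allFin n)

-- number of orbits of ⟨fs⟩ meeting U (U is assumed ⟨fs⟩-invariant)
nOrbitsOn : ∀ {n} → List (Fin n → Fin n) → VSet n → ℕ
nOrbitsOn fs U = count (λ v → U v ∧ isRep fs v)

nOrbitsInside : ∀ {n} → List (Fin n → Fin n) → VSet n → ℕ
nOrbitsInside fs S = count (λ v → isRep fs v ∧ (orbit fs v ⊆ᵇ S))

full : ∀ {n} → VSet n
full _ = true

allSubsets : ∀ n → List (VSet n)
allSubsets zero    = (λ ()) ∷ []
allSubsets (suc n) = concatMap (λ X → ext true X ∷ ext false X ∷ []) (allSubsets n)
  where
  ext : Bool → VSet n → VSet (suc n)
  ext x X zero    = x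
  ext x X (suc i) = X i

module _ (H : Gehm) where
  open Gehm H

  -- hyperedges = b–r-cycles = orbits of ⟨b,r⟩,
  -- hypervertices = g–r-cycles (+ isolates), hyperfaces = b–g-cycles (+ isolates),
  -- components = orbits of ⟨b,g,r⟩ (+ isolates).
  eH : ℕ
  eH = nOrbitsOn (b ∷ r ∷ []) full

  vH : ℕ
  vH = nOrbitsOn (g ∷ r ∷ []) full ℕ.+ isolates

  fH : ℕ
  fH = nOrbitsOn (b ∷ g ∷ []) full ℕ.+ isolates

  kH : ℕ
  kH = nOrbitsOn (b ∷ g ∷ r ∷ []) full ℕ.+ isolates

  -- d(e) = half the number of gehm-edges of the b–r-cycle e; a b–r-cycle
  -- with m vertices has m edges, so d(H) = (number of vertices)/2.
  dH : ℕ
  dH = count (full {n}) / 2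

  γH : ℤ
  γH = + (2 ℕ.* kH) ℤ.- + vH ℤ.- + eH ℤ.+ + dH ℤ.- + fH

  -- twice ρ(H)  (ρ may be a half-integer, γ need not be even)
  ρ₂H : ℤ
  ρ₂H = + (2 ℕ.* vH) ℤ.- + (2 ℕ.* kH) ℤ.+ γH

  -- Subsets A ⊆ E(H) are represented by the vertex set U of their
  -- hyperedges, i.e. by subsets U ⊆ V closed under b and r.

  brClosed : VSet n → Bool
  brClosed U = all (λ w → not (U w) ∨ (U (b w) ∧ U (r w))) (allFin n)

  hyperedgeSubsets : List (VSet n)
  hyperedgeSubsets = filterᵇ brClosed (allSubsets n)

  -- H_{|A}: delete all hyperedges not in A, i.e. with vertex set S = V∖U.
  -- Deleting the b-edges and contracting the r-edges of those hyperedges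
  -- and suppressing the resulting degree-two vertices leaves the vertices
  -- of U with their b- and r-edges; the new g-edge at u ∈ U goes to the
  -- first vertex of U reached along the walk g, r, g, r, …, g from u
  -- (a chain of suppressed degree-two vertices), and every g–r-cycle lying
  -- entirely inside S becomes one new isolate.

  module Restrict (U : VSet n) where
    S : VSet n
    S w = not (U w)

    exit : ℕ → Fin n → Fin n
    exit zero    w = w
    exit (suc k) w = if U w then w else exit k (g (r w))

    g′ : Fin n → Fin n
    g′ v = exit n (g v)

    newIsolates : ℕ
    newIsolates = nOrbitsInside (g ∷ r ∷ []) S

    eA : ℕ
    eA = nOrbitsOn (b ∷ r ∷ []) U

    dA : ℕ
    dA = count U / 2

    vA : ℕ
    vA = nOrbitsOn (g′ ∷ r ∷ []) U ℕ.+ isolates ℕ.+ newIsolates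

    fA : ℕ
    fA = nOrbitsOn (b ∷ g′ ∷ []) U ℕ.+ isolates ℕ.+ newIsolates

    kA : ℕ
    kA = nOrbitsOn (b ∷ g′ ∷ r ∷ []) U ℕ.+ isolates ℕ.+ newIsolates

    γA : ℤ
    γA = + (2 ℕ.* kA) ℤ.- + vA ℤ.- + eA ℤ.+ + dA ℤ.- + fA
  
    ρ₂A : ℤ
    ρ₂A = + (2 ℕ.* vA) ℤ.- + (2 ℕ.* kA) ℤ.+ γA

module _ {c ℓ : Level} (R : CommutativeRing c ℓ) where
  open CommutativeRing R

  pow : Carrier → ℕ → Carrier
  pow a zero    = 1#
  pow a (suc k) = a * pow a k

  -- integer power of a unit a with (intended) inverse a⁻
  zpow : Carrier → Carrier → ℤ → Carrier
  zpow a a⁻ (+ k)     = pow a k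
  zpow a a⁻ -[1+ k ]  = pow a⁻ (suc k)

  ΣR : List Carrier → Carrier
  ΣR = foldr _+_ 0#

  -- T(H; X+1, Y+1) where a = √X, b = √Y (a⁻, b⁻ their inverses):
  -- (X)^{ρ(H)-ρ(A)} = a^{2ρ(H)-2ρ(A)},  (Y)^{d(A)-|A|-ρ(A)} = b^{2(d(A)-|A|)-2ρ(A)}.
  Tshift : Gehm → Carrier → Carrier → Carrier → Carrier → Carrier
  Tshift H a a⁻ b′ b⁻ = ΣR (map term (hyperedgeSubsets H))
    where
    open Gehm H using (n)
    term : VSet n → Carrier
    term U = zpow a a⁻ (ρ₂H H ℤ.- ρ₂A)
           * zpow b′ b⁻ ((+ 2) ℤ.* (+ dA ℤ.- + eA) ℤ.- ρ₂A)
      where open Restrict H U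

  Zpoly : Gehm → Carrier → Carrier → Carrier → Carrier
  Zpoly H u u⁻ w = ΣR (map term (hyperedgeSubsets H))
    where
    open Gehm H using (n)
    term : VSet n → Carrier
    term U = zpow u u⁻ (+ dA ℤ.- + eA) * pow w fA
      where open Restrict H U

{-# OPTIONS --safe #-}
module Submission where

-- Deleting hyperedges never changes the number of hypervertices.  Keep the hyperedges with vertex set U
-- (closed under b and r).  A g–r-cycle meeting U survives as exactly one g′–r-cycle on its vertices in U,
-- because g′ short-cuts the g, r, …, g detours through the deleted vertices; a g–r-cycle missing U becomes
-- one new isolate.  So v(A) = v(H) for every A.  Then 2ρ = v − e + d − f (the 2k in γ cancels), and for
-- every A the exponents of √x and √y in the term of T(H; x+1, y+1) are those of the term of Z at
-- (√y/√x, √x√y), shifted by d(H) − e(H) − f(H) and −v(H) respectively.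

open import Defs
open import Algebra.Bundles using (CommutativeRing)
open import Data.Bool using (Bool; true; false; not; _∧_; _∨_; if_then_else_; T)
open import Data.Bool.ListAction using (all; any)
open import Data.Bool.Properties using (T-∧; T-∨)
open import Data.Empty using (⊥-elim)
open import Data.Fin using (Fin; zero; suc; toℕ; _≟_)
open import Data.Fin.Properties using (¬∀⟶∃¬; suc-injective; toℕ-injective; toℕ<n; pigeonhole)
open import Data.Integer as ℤ using (ℤ; +_)
open import Data.Integer.Properties using ([1+m]⊖[1+n]≡m⊖n; pos-*)
open import Data.Integer.Tactic.RingSolver using (solve-∀)
open import Data.List using (List; []; _∷_; map; tabulate; allFin)
open import Data.List.Membership.Propositional using (_∈_; lose)
open import Data.List.Membership.Propositional.Properties using (∈-allFin; ∈-filter⁻)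
open import Data.List.Properties using (map-tabulate)
open import Data.List.Relation.Unary.All as All using (All; []; _∷_)
open import Data.List.Relation.Unary.All.Properties using (all⁺; all⁻)
open import Data.List.Relation.Unary.Any as Any using (Any; here; there; satisfied)
open import Data.List.Relation.Unary.Any.Properties using (any⁺; any⁻)
open import Data.Nat as ℕ using (ℕ; zero; suc; _+_; _≤_; _<_; z≤n; s≤s; z<s)
import Data.Nat.ListAction as List
open import Data.Nat.Properties
  using (+-0-commutativeMonoid; +-commutativeSemigroup; +-comm; +-suc; +-mono-≤; +-mono-<-≤; +-mono-≤-<;
         ≤-refl; ≤-trans; ≤-antisym; ≤-pred; <-cmp; <⇒≱; n<1+n; m<n⇒m<1+n; m≤n+m; m≤n⇒m<n∨m≡n;
         m≤n⇒∃[o]m+o≡n; ≤ᵇ⇒≤; ≤⇒≤ᵇ; module ≤-Reasoning)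
open import Algebra.Properties.CommutativeMonoid.Sum +-0-commutativeMonoid
  using (sum-syntax; ∑-comm; ∑-distrib-+; sum-cong-≗)
open import Algebra.Properties.CommutativeSemigroup +-commutativeSemigroup using (xy∙z≈xz∙y)
open import Data.Product using (∃; ∃!; _×_; _,_; proj₁; proj₂)
open import Data.Sum using (_⊎_; inj₁; inj₂)
open import Function using (id; _∘_; _⇔_; mk⇔; Equivalence; case_of_)
open import Level using (Level)
open import Relation.Binary using (tri<; tri≈; tri>)
open import Relation.Binary.Construct.Closure.ReflexiveTransitive using (Star; ε; _◅_; _◅◅_; reverse; foldl)
open import Relation.Binary.PropositionalEquality
  using (_≡_; refl; sym; trans; cong; cong₂; subst; module ≡-Reasoning)
open import Relation.Nullary using (¬_; yes; no; contradiction)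
open import Relation.Nullary.Decidable using (⌊_⌋; T?; _→-dec_; toWitness; fromWitness; decidable-stable)
open import Relation.Unary using (_⊆_)

open Equivalence using (to; from)

T-not-∨ : ∀ {a b} → T (not a ∨ b) ⇔ (T a → T b)
T-not-∨ {true}  = mk⇔ (λ tb _ → tb) (λ f → f _)
T-not-∨ {false} = mk⇔ (λ _ ()) _

T-not : ∀ {b} → T (not b) ⇔ (¬ T b)
T-not {true}  = mk⇔ (λ ()) (λ ¬t → ¬t _)
T-not {false} = mk⇔ (λ _ ()) _

T-¬⇒ : ∀ {a b} → ¬ (T a → T b) → T a × ¬ T b
T-¬⇒ {true}  ¬a⇒b = _ , λ tb → ¬a⇒b (λ _ → tb)
T-¬⇒ {false} ¬a⇒b = contradiction (λ ()) ¬a⇒b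

module _ {n : ℕ} where

  T-all-allFin : (p : Fin n → Bool) → T (all p (allFin n)) ⇔ (∀ i → T (p i))
  T-all-allFin p = mk⇔ (λ t i → All.lookup (all⁺ p (allFin n) t) (∈-allFin i))
                       (λ h → all⁻ p {allFin n} (All.tabulate (λ {i} _ → h i)))

  T-any-allFin : (p : Fin n → Bool) → T (any p (allFin n)) ⇔ ∃ (T ∘ p)
  T-any-allFin p = mk⇔ (satisfied ∘ any⁻ p (allFin n))
                       (λ (i , t) → any⁺ p (lose {xs = allFin n} (∈-allFin i) t))

  T-⊆ᵇ : (X Y : VSet n) → T (X ⊆ᵇ Y) ⇔ (T ∘ X ⊆ T ∘ Y)
  T-⊆ᵇ X Y = mk⇔ (λ t {w} → to T-not-∨ (to (T-all-allFin _) t w))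
                 (λ X⊆Y → from (T-all-allFin _) (λ w → from T-not-∨ (X⊆Y {w})))

  ⊈ᵇ⇒∃ : (X Y : VSet n) → ¬ T (X ⊆ᵇ Y) → ∃ λ w → T (X w) × ¬ T (Y w)
  ⊈ᵇ⇒∃ X Y X⊈Y with ¬∀⟶∃¬ n _ (λ w → T? (X w) →-dec T? (Y w))
                                 (λ X⇒Y → X⊈Y (from (T-⊆ᵇ X Y) (λ {w} → X⇒Y w)))
  ... | w , ¬X⇒Y = w , T-¬⇒ ¬X⇒Y

𝟙 : Bool → ℕ
𝟙 b = if b then 1 else 0

𝟙≤1 : ∀ b → 𝟙 b ≤ 1
𝟙≤1 true  = s≤s z≤n
𝟙≤1 false = z≤n

𝟙-mono : ∀ {a b} → (T a → T b) → 𝟙 a ≤ 𝟙 b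
𝟙-mono {false}         _   = z≤n
𝟙-mono {true}  {true}  _   = ≤-refl
𝟙-mono {true}  {false} a⇒b = ⊥-elim (a⇒b _)

𝟙-< : ∀ {a b} → ¬ T a → T b → 𝟙 a < 𝟙 b
𝟙-< {false} {true} _ _ = s≤s z≤n
𝟙-< {true}         ¬a _ = contradiction _ ¬a

𝟙-split : ∀ a b → 𝟙 a ≡ 𝟙 (a ∧ b) + 𝟙 (a ∧ not b)
𝟙-split true  true  = refl
𝟙-split true  false = refl
𝟙-split false _     = refl

sumˡ-tabulate : ∀ {n} (f : Fin n → ℕ) → List.sum (tabulate f) ≡ ∑[ i < n ] f i
sumˡ-tabulate {zero}  f = refl
sumˡ-tabulate {suc n} f = cong (ℕ._+_ (f zero)) (sumˡ-tabulate (f ∘ suc))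

count≡∑ : ∀ {n} (X : VSet n) → count X ≡ ∑[ w < n ] 𝟙 (X w)
count≡∑ X = trans (cong List.sum (map-tabulate (λ w → w) (𝟙 ∘ X))) (sumˡ-tabulate (𝟙 ∘ X))

count-suc : ∀ {n} (X : VSet (suc n)) → count X ≡ 𝟙 (X zero) + count (X ∘ suc)
count-suc X = trans (count≡∑ X) (cong (ℕ._+_ (𝟙 (X zero))) (sym (count≡∑ (X ∘ suc))))

count≤n : ∀ {n} (X : VSet n) → count X ≤ n
count≤n {zero}  X = z≤n
count≤n {suc n} X = begin
  count X                       ≡⟨ count-suc X ⟩
  𝟙 (X zero) + count (X ∘ suc)  ≤⟨ +-mono-≤ (𝟙≤1 (X zero)) (count≤n (X ∘ suc)) ⟩
  suc n                         ∎
  where open ≤-Reasoning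

count-mono : ∀ {n} (X Y : VSet n) → T ∘ X ⊆ T ∘ Y → count X ≤ count Y
count-mono {zero}  X Y X⊆Y = z≤n
count-mono {suc n} X Y X⊆Y = begin
  count X                       ≡⟨ count-suc X ⟩
  𝟙 (X zero) + count (X ∘ suc)  ≤⟨ +-mono-≤ (𝟙-mono X⊆Y) (count-mono (X ∘ suc) (Y ∘ suc) X⊆Y) ⟩
  𝟙 (Y zero) + count (Y ∘ suc)  ≡⟨ count-suc Y ⟨
  count Y                       ∎
  where open ≤-Reasoning

count-mono-< : ∀ {n} (X Y : VSet n) → T ∘ X ⊆ T ∘ Y → ∀ {a} → ¬ T (X a) → T (Y a) → count X < count Y
count-mono-< {suc n} X Y X⊆Y {a} ¬Xa Ya = begin-strict
  count X                       ≡⟨ count-suc X ⟩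
  𝟙 (X zero) + count (X ∘ suc)  <⟨ head-or-tail a ¬Xa Ya ⟩
  𝟙 (Y zero) + count (Y ∘ suc)  ≡⟨ count-suc Y ⟨
  count Y                       ∎
  where
  open ≤-Reasoning
  head-or-tail : ∀ a → ¬ T (X a) → T (Y a) → 𝟙 (X zero) + count (X ∘ suc) < 𝟙 (Y zero) + count (Y ∘ suc)
  head-or-tail zero    ¬Xa Ya = +-mono-<-≤ (𝟙-< ¬Xa Ya) (count-mono (X ∘ suc) (Y ∘ suc) X⊆Y)
  head-or-tail (suc a) ¬Xa Ya = +-mono-≤-< (𝟙-mono X⊆Y) (count-mono-< (X ∘ suc) (Y ∘ suc) X⊆Y ¬Xa Ya)

count-empty : ∀ {n} (X : VSet n) → (∀ w → ¬ T (X w)) → count X ≡ 0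
count-empty {zero}  X _     = refl
count-empty {suc n} X empty = begin
  count X                        ≡⟨ count-suc X ⟩
  𝟙 (X zero) + count (X ∘ suc)   ≡⟨ cong₂ _+_ (𝟙-false (empty zero))
                                               (count-empty (X ∘ suc) (empty ∘ suc)) ⟩
  0                              ∎
  where
  open ≡-Reasoning
  𝟙-false : ∀ {b} → ¬ T b → 𝟙 b ≡ 0
  𝟙-false {false} _  = refl
  𝟙-false {true}  ¬b = contradiction _ ¬b

count-unique : ∀ {n} (X : VSet n) → ∃! _≡_ (T ∘ X) → count X ≡ 1
count-unique {suc n} X (a , Xa , unique) = begin
  count X                       ≡⟨ count-suc X ⟩
  𝟙 (X zero) + count (X ∘ suc)  ≡⟨ head-or-tail a Xa unique ⟩
  1                             ∎
  where
  open ≡-Reasoning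
  head-or-tail : ∀ a → T (X a) → (∀ {w} → T (X w) → a ≡ w) → 𝟙 (X zero) + count (X ∘ suc) ≡ 1
  head-or-tail zero    X0 unique with X zero
  ... | true = cong suc (count-empty (X ∘ suc) (λ w Xw → case unique Xw of λ ()))
  head-or-tail (suc a) Xa unique with X zero in X0
  ... | false = count-unique (X ∘ suc) (a , Xa , suc-injective ∘ unique)
  ... | true  = case unique (subst T (sym X0) _) of λ ()

count≡𝟙 : ∀ {n} (X : VSet n) {b : Bool} →
          (T b → ∃! _≡_ (T ∘ X)) → (¬ T b → ∀ w → ¬ T (X w)) → count X ≡ 𝟙 b
count≡𝟙 X {true}  unique _     = count-unique X (unique _)
count≡𝟙 X {false} _      empty = count-empty X (empty λ ())

count-split : ∀ {n} (X Y : VSet n) → count X ≡ count (λ w → X w ∧ Y w) + count (λ w → X w ∧ not (Y w))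
count-split {n} X Y = begin
  count X                                      ≡⟨ count≡∑ X ⟩
  ∑[ w < n ] 𝟙 (X w)                           ≡⟨ sum-cong-≗ (λ w → 𝟙-split (X w) (Y w)) ⟩
  ∑[ w < n ] (𝟙 (X∧Y w) + 𝟙 (X∖Y w))           ≡⟨ ∑-distrib-+ (𝟙 ∘ X∧Y) (𝟙 ∘ X∖Y) ⟩
  ∑[ w < n ] 𝟙 (X∧Y w) + ∑[ w < n ] 𝟙 (X∖Y w)  ≡⟨ cong₂ _+_ (count≡∑ X∧Y) (count≡∑ X∖Y) ⟨
  count X∧Y + count X∖Y                        ∎
  where
  open ≡-Reasoning
  X∧Y X∖Y : VSet n
  X∧Y w = X w ∧ Y w
  X∖Y w = X w ∧ not (Y w)

least : ∀ {n} (X : VSet n) → ∀ {a} → T (X a) →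
        ∃ λ m → T (X m) × (∀ {w} → T (X w) → toℕ m ≤ toℕ w)
least {suc n} X {a} Xa with T? (X zero)
... | yes X0 = zero , X0 , λ _ → z≤n
... | no ¬X0 with a
...   | zero  = contradiction Xa ¬X0
...   | suc a with least (X ∘ suc) Xa
...     | m , Xm , minimal =
  suc m , Xm , λ { {zero} X0 → contradiction X0 ¬X0 ; {suc w} Xw → s≤s (minimal Xw) }

Step : ∀ {n} → List (Fin n → Fin n) → Fin n → Fin n → Set
Step fs u w = Any (λ f → f u ≡ w) fs

Involutions : ∀ {n} → List (Fin n → Fin n) → Set
Involutions = All (λ f → ∀ x → f (f x) ≡ x)

Step-sym : ∀ {n} {fs : List (Fin n → Fin n)} → Involutions fs → ∀ {u w} → Step fs u w → Step fs w u
Step-sym (f-invol ∷ _)      (here refl) = here (f-invol _)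
Step-sym (_ ∷ fs-involutive) (there s)   = there (Step-sym fs-involutive s)

module Orbits {n : ℕ} (fs : List (Fin n → Fin n)) where

  Reach : Fin n → Fin n → Set
  Reach = Star (Step fs)

  Reach-sym : Involutions fs → ∀ {u w} → Reach u w → Reach w u
  Reach-sym fs-involutive = reverse (Step-sym fs-involutive)

  Closed : VSet n → Set
  Closed X = ∀ {u w} → Step fs u w → T (X u) → T (X w)

  Closed-Reach : ∀ {X} → Closed X → ∀ {u w} → Reach u w → T (X u) → T (X w)
  Closed-Reach closed ε       = id
  Closed-Reach closed (s ◅ p) = Closed-Reach closed p ∘ closed s

  closeStep-⊇ : ∀ X {w} → T (X w) → T (closeStep fs X w)
  closeStep-⊇ X Xw = from T-∨ (inj₁ Xw)

  closeStep-Step : ∀ X {u w} → Step fs u w → T (X u) → T (closeStep fs X w)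
  closeStep-Step X {u} s Xu =
    from T-∨ (inj₂ (from (T-any-allFin _) (u , from T-∧ (Xu , any⁺ _ (Any.map fromWitness s)))))

  closeStep⁻ : ∀ X {w} → T (closeStep fs X w) → T (X w) ⊎ ∃ λ u → T (X u) × Step fs u w
  closeStep⁻ X t with to T-∨ t
  ... | inj₁ Xw = inj₁ Xw
  ... | inj₂ t′ with to (T-any-allFin _) t′
  ...   | u , t″ with to T-∧ t″
  ...     | Xu , t‴ = inj₂ (u , Xu , Any.map toWitness (any⁻ _ fs t‴))

  closeStep-Closed : ∀ {X} → Closed X → Closed (closeStep fs X)
  closeStep-Closed {X} closed s t = closeStep-⊇ X (closed s (stays t))
    where
    stays : ∀ {u} → T (closeStep fs X u) → T (X u)
    stays t with closeStep⁻ X t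
    ... | inj₁ Xu             = Xu
    ... | inj₂ (_ , Xu′ , s′) = closed s′ Xu′

  Closed-or-grows : ∀ X → Closed X ⊎ count X < count (closeStep fs X)
  Closed-or-grows X with T? (closeStep fs X ⊆ᵇ X)
  ... | yes step⊆X = inj₁ λ s Xu → to (T-⊆ᵇ _ X) step⊆X (closeStep-Step X s Xu)
  ... | no  step⊈X with ⊈ᵇ⇒∃ _ X step⊈X
  ...   | w , t , ¬Xw = inj₂ (count-mono-< X _ (closeStep-⊇ X) ¬Xw t)

  closure : ℕ → Fin n → VSet n
  closure k v = iterate k (closeStep fs) (λ w → ⌊ w ≟ v ⌋)

  closure-∋ : ∀ k v → T (closure k v v)
  closure-∋ zero    v = fromWitness refl
  closure-∋ (suc k) v = closeStep-⊇ _ (closure-∋ k v)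

  closure⇒Reach : ∀ k {v w} → T (closure k v w) → Reach v w
  closure⇒Reach zero    {v} t = subst (Reach v) (sym (toWitness t)) ε
  closure⇒Reach (suc k)     t with closeStep⁻ _ t
  ... | inj₁ t′           = closure⇒Reach k t′
  ... | inj₂ (_ , t′ , s) = closure⇒Reach k t′ ◅◅ (s ◅ ε)

  closure-Closed-or-large : ∀ k v → Closed (closure k v) ⊎ k < count (closure k v)
  closure-Closed-or-large zero    v = inj₂ (subst (0 <_) (sym (count-unique _ singleton)) z<s)
    where
    singleton : ∃! _≡_ (λ w → T ⌊ w ≟ v ⌋)
    singleton = v , fromWitness refl , λ t → sym (toWitness t)
  closure-Closed-or-large (suc k) v with closure-Closed-or-large k v
  ... | inj₁ closed = inj₁ (closeStep-Closed closed)
  ... | inj₂ large with Closed-or-grows (closure k v)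
  ...   | inj₁ closed = inj₁ (closeStep-Closed closed)
  ...   | inj₂ grows  = inj₂ (≤-trans (s≤s large) grows)

  -- n closure steps suffice because each non-final step adds a vertex.
  orbit-Closed : ∀ v → Closed (orbit fs v)
  orbit-Closed v with closure-Closed-or-large n v
  ... | inj₁ closed = closed
  ... | inj₂ large  = contradiction (count≤n (orbit fs v)) (<⇒≱ large)

  T-orbit : ∀ {v w} → T (orbit fs v w) ⇔ Reach v w
  T-orbit {v} = mk⇔ (closure⇒Reach n) (λ p → Closed-Reach (orbit-Closed v) p (closure-∋ n v))

  T-isRep : ∀ {v} → T (isRep fs v) ⇔ (∀ {w} → Reach v w → toℕ v ≤ toℕ w)
  T-isRep {v} = mk⇔ (λ t {w} p → ≤ᵇ⇒≤ _ _ (to (T-⊆ᵇ (orbit fs v) above-v) t (from T-orbit p)))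
                    (λ minimal → from (T-⊆ᵇ (orbit fs v) above-v) (≤⇒≤ᵇ ∘ minimal ∘ to T-orbit))
    where
    above-v : VSet n
    above-v w = toℕ v ℕ.≤ᵇ toℕ w

  module _ (fs-involutive : Involutions fs) where

    isRep-unique : ∀ u → ∃! _≡_ (λ v → T (isRep fs v ∧ orbit fs v u))
    isRep-unique u with least (orbit fs u) (from T-orbit ε)
    ... | m , u~m , m-least = m , from T-∧ (isRep-m , from T-orbit (Reach-sym fs-involutive (to T-orbit u~m))) , unique
      where
      isRep-m : T (isRep fs m)
      isRep-m = from T-isRep (λ m~w → m-least (from T-orbit (to T-orbit u~m ◅◅ m~w)))
      unique : ∀ {x} → T (isRep fs x ∧ orbit fs x u) → m ≡ x
      unique t with to T-∧ t
      ... | isRep-x , x~u = toℕ-injective (≤-antisym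
              (m-least (from T-orbit (Reach-sym fs-involutive (to T-orbit x~u))))
              (to T-isRep isRep-x (to T-orbit x~u ◅◅ to T-orbit u~m)))

-- Double counting the pairs (fs-representative v, fs′-representative u ∈ U) with u in the fs-orbit of v.
module _ {n : ℕ} (fs fs′ : List (Fin n → Fin n)) (fs-involutive : Involutions fs) (U : VSet n)
         (restrict : ∀ {u w} → T (U u) → Orbits.Reach fs′ u w ⇔ (Orbits.Reach fs u w × T (U w)))
         where

  open Orbits fs using (Reach; Reach-sym; T-orbit; T-isRep; isRep-unique)
  open Orbits fs′ using () renaming (T-isRep to T-isRep′)

  private
    avoidsU : Fin n → Bool
    avoidsU v = orbit fs v ⊆ᵇ (λ w → not (U w))

    avoiding meeting : VSet n
    avoiding v = isRep fs v ∧ avoidsU v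
    meeting  v = isRep fs v ∧ not (avoidsU v)

    Pair : Fin n → Fin n → Bool
    Pair v u = (isRep fs v ∧ orbit fs v u) ∧ (U u ∧ isRep fs′ u)

    T-Pair : ∀ {v u} → T (Pair v u) ⇔ (T (isRep fs v ∧ orbit fs v u) × T (U u ∧ isRep fs′ u))
    T-Pair {v} {u} = T-∧ {isRep fs v ∧ orbit fs v u} {U u ∧ isRep fs′ u}

    column : ∀ u → count (λ v → Pair v u) ≡ 𝟙 (U u ∧ isRep fs′ u)
    column u = count≡𝟙 (λ v → Pair v u) unique empty
      where
      unique : T (U u ∧ isRep fs′ u) → ∃! _≡_ (λ v → T (Pair v u))
      unique t with isRep-unique fs-involutive u
      ... | m , tm , m-unique = m , from T-Pair (tm , t) , m-unique ∘ proj₁ ∘ to T-Pair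
      empty : ¬ T (U u ∧ isRep fs′ u) → ∀ v → ¬ T (Pair v u)
      empty ¬t v = ¬t ∘ proj₂ ∘ to T-Pair

    meets-U : ∀ {v} → T (not (avoidsU v)) → ∃ λ w → T (U w ∧ orbit fs v w)
    meets-U {v} meets with ⊈ᵇ⇒∃ (orbit fs v) (λ w → not (U w)) (to T-not meets)
    ... | w , v~w , ¬¬Uw = w , from T-∧ (decidable-stable (T? (U w)) (¬¬Uw ∘ from T-not) , v~w)

    row : ∀ v → count (Pair v) ≡ 𝟙 (isRep fs v ∧ not (avoidsU v))
    row v = count≡𝟙 (Pair v) unique empty
      where
      unique : T (isRep fs v ∧ not (avoidsU v)) → ∃! _≡_ (λ u → T (Pair v u))
      unique t with to T-∧ t
      ... | isRep-v , meets with least (λ u → U u ∧ orbit fs v u) (proj₂ (meets-U meets))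
      ...   | m , t′ , m-least with to T-∧ t′
      ...     | Um , v~m = m , from T-Pair (from T-∧ (isRep-v , v~m) , from T-∧ (Um , isRep′-m)) , m-unique
        where
        isRep′-m : T (isRep fs′ m)
        isRep′-m = from T-isRep′ λ m~′x → let (m~x , Ux) = to (restrict Um) m~′x in
          m-least (from T-∧ (Ux , from T-orbit (to T-orbit v~m ◅◅ m~x)))
        m-unique : ∀ {x} → T (Pair v x) → m ≡ x
        m-unique t″ with to T-Pair t″
        ... | tv , tx with to T-∧ tv | to T-∧ tx
        ...   | _ , v~x | Ux , isRep′-x = toℕ-injective (≤-antisym
                (m-least (from T-∧ (Ux , v~x)))
                (to T-isRep′ isRep′-x (from (restrict Ux) (x~m , Um))))
          where x~m = Reach-sym fs-involutive (to T-orbit v~x) ◅◅ to T-orbit v~m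
      empty : ¬ T (isRep fs v ∧ not (avoidsU v)) → ∀ u → ¬ T (Pair v u)
      empty ¬t u t with to T-Pair t
      ... | tv , tu with to T-∧ tv
      ...   | isRep-v , v~u = ¬t (from T-∧ (isRep-v , from T-not avoids⇒⊥))
        where
        avoids⇒⊥ : ¬ T (avoidsU v)
        avoids⇒⊥ avoids = to T-not (to (T-⊆ᵇ (orbit fs v) (λ w → not (U w))) avoids v~u) (proj₁ (to T-∧ tu))

    nOrbitsOn≡meeting : nOrbitsOn fs′ U ≡ count meeting
    nOrbitsOn≡meeting = begin
      count (λ u → U u ∧ isRep fs′ u)     ≡⟨ count≡∑ (λ u → U u ∧ isRep fs′ u) ⟩
      ∑[ u < n ] 𝟙 (U u ∧ isRep fs′ u)    ≡⟨ sum-cong-≗ (λ u → trans (sym (column u))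
                                                                    (count≡∑ (λ v → Pair v u))) ⟩
      ∑[ u < n ] ∑[ v < n ] 𝟙 (Pair v u)  ≡⟨ ∑-comm (λ v u → 𝟙 (Pair v u)) ⟨
      ∑[ v < n ] ∑[ u < n ] 𝟙 (Pair v u)  ≡⟨ sum-cong-≗ (λ v → trans (sym (count≡∑ (Pair v))) (row v)) ⟩
      ∑[ v < n ] 𝟙 (meeting v)            ≡⟨ count≡∑ meeting ⟨
      count meeting                       ∎
      where open ≡-Reasoning

  nOrbitsOn-restrict : nOrbitsOn fs′ U + nOrbitsInside fs (λ w → not (U w)) ≡ nOrbitsOn fs full
  nOrbitsOn-restrict = begin
    nOrbitsOn fs′ U + count avoiding  ≡⟨ cong (_+ count avoiding) nOrbitsOn≡meeting ⟩
    count meeting + count avoiding    ≡⟨ +-comm (count meeting) (count avoiding) ⟩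
    count avoiding + count meeting    ≡⟨ count-split (isRep fs) avoidsU ⟨
    count (isRep fs)                  ∎
    where open ≡-Reasoning

least-unique : {P : ℕ → Set} → ∀ {j k} →
               (∀ {i} → i < j → ¬ P i) → P j → (∀ {i} → i < k → ¬ P i) → P k → j ≡ k
least-unique {j = j} {k} j-least Pj k-least Pk with <-cmp j k
... | tri< j<k _ _ = contradiction Pj (k-least j<k)
... | tri≈ _ j≡k _ = j≡k
... | tri> _ _ k<j = contradiction Pk (j-least k<j)

module Deletion (H : Gehm) (U : VSet (Gehm.n H)) (U-r-closed : ∀ {w} → T (U w) → T (U (Gehm.r H w))) where

  open Gehm H
  open Restrict H U using (exit; g′)

  gr g′r : List (Fin n → Fin n)
  gr  = g ∷ r ∷ []
  g′r = g′ ∷ r ∷ []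

  open Orbits gr using (Reach)
  open Orbits g′r using () renaming (Reach to Reach′)

  h : Fin n → Fin n
  h = g ∘ r

  h^ : ℕ → Fin n → Fin n
  h^ k = iterate k h

  h-path : ∀ {x} → Reach x (h x)
  h-path = there (here refl) ◅ here refl ◅ ε

  ¬U-r : ∀ {w} → ¬ T (U w) → ¬ T (U (r w))
  ¬U-r {w} ¬Uw Urw = ¬Uw (subst (T ∘ U) (r-invol w) (U-r-closed Urw))

  h-injective : ∀ {x y} → h x ≡ h y → x ≡ y
  h-injective {x} {y} hx≡hy = begin
    x                ≡⟨ r-invol x ⟨
    r (r x)          ≡⟨ cong r (g-invol (r x)) ⟨
    r (g (h x))      ≡⟨ cong (r ∘ g) hx≡hy ⟩
    r (g (h y))      ≡⟨ cong r (g-invol (r y)) ⟩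
    r (r y)          ≡⟨ r-invol y ⟩
    y                ∎
    where open ≡-Reasoning

  h^-injective : ∀ k {x y} → h^ k x ≡ h^ k y → x ≡ y
  h^-injective zero    eq = eq
  h^-injective (suc k) eq = h^-injective k (h-injective eq)

  h^-suc : ∀ i x → h^ i (h x) ≡ h^ (suc i) x
  h^-suc zero    x = refl
  h^-suc (suc i) x = cong h (h^-suc i x)

  h^-+ : ∀ i j x → h^ (i + j) x ≡ h^ i (h^ j x)
  h^-+ zero    j x = refl
  h^-+ (suc i) j x = cong h (h^-+ i j x)

  h-periodic : ∀ y → ∃ λ p → p < n × h^ (suc p) y ≡ y
  h-periodic y with pigeonhole (n<1+n n) (λ (i : Fin (suc n)) → h^ (toℕ i) y)
  ... | i , j , i<j , hⁱy≡hʲy with m≤n⇒∃[o]m+o≡n i<j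
  ... | p , 1+i+p≡j = p , p<n , sym (h^-injective (toℕ i) (begin
      h^ (toℕ i) y               ≡⟨ hⁱy≡hʲy ⟩
      h^ (toℕ j) y               ≡⟨ cong (λ k → h^ k y) (trans (sym 1+i+p≡j) (sym (+-suc (toℕ i) p))) ⟩
      h^ (toℕ i + suc p) y       ≡⟨ h^-+ (toℕ i) (suc p) y ⟩
      h^ (toℕ i) (h^ (suc p) y)  ∎))
    where
    open ≡-Reasoning
    p<n : p < n
    p<n = ≤-trans (s≤s (m≤n+m p (toℕ i))) (subst (_≤ n) (sym 1+i+p≡j) (≤-pred (toℕ<n j)))

  -- h (r x) = g x, so walking the h-orbit of g x leads back to r x.
  g-reaches-r : ∀ x → ∃ λ p → p < n × h^ p (g x) ≡ r x
  g-reaches-r x with h-periodic (g x)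
  ... | p , p<n , period = p , p<n , h-injective (trans period (cong g (sym (r-invol x))))

  Avoids : Fin n → ℕ → Set
  Avoids y j = ∀ {i} → i < j → ¬ T (U (h^ i y))

  Avoids-pred : ∀ {y j} → Avoids y (suc j) → Avoids y j
  Avoids-pred avoids i<j = avoids (m<n⇒m<1+n i<j)

  Avoids-suc : ∀ {y j} → Avoids y j → ¬ T (U (h^ j y)) → Avoids y (suc j)
  Avoids-suc avoids ¬U i<1+j with m≤n⇒m<n∨m≡n (≤-pred i<1+j)
  ... | inj₁ i<j  = avoids i<j
  ... | inj₂ refl = ¬U

  Avoids-cons : ∀ {y j} → ¬ T (U y) → Avoids (h y) j → Avoids y (suc j)
  Avoids-cons ¬Uy avoids {zero}  _         = ¬Uy
  Avoids-cons ¬Uy avoids {suc i} (s≤s i<j) = avoids i<j ∘ subst (T ∘ U) (sym (h^-suc i _))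

  exit-spec : ∀ k y → ∃ λ j → exit k y ≡ h^ j y × Avoids y j
  exit-spec zero    y = 0 , refl , λ ()
  exit-spec (suc k) y with U y in Uy
  ... | true  = 0 , refl , λ ()
  ... | false with exit-spec k (h y)
  ...   | j , eq , avoids = suc j , trans eq (h^-suc j y) , Avoids-cons (subst T Uy) avoids

  exit-fixed : ∀ k {z} → T (U z) → exit k z ≡ z
  exit-fixed zero    _  = refl
  exit-fixed (suc k) {z} Uz with U z | Uz
  ... | true | _ = refl

  exit-hits : ∀ {j k y} → j < k → T (U (h^ j y)) → T (U (exit k y))
  exit-hits {j} {suc k} {y} j<k Uhʲy with U y in Uy
  ... | true = subst T (sym Uy) _
  exit-hits {zero}  {suc k} {y} j<k Uy′ | false = ⊥-elim (subst T Uy Uy′)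
  exit-hits {suc j} {suc k} {y} j<k Uhʲy | false =
    exit-hits (≤-pred j<k) (subst (T ∘ U) (sym (h^-suc j y)) Uhʲy)

  g′-∈U : ∀ {x} → T (U x) → T (U (g′ x))
  g′-∈U {x} Ux with g-reaches-r x
  ... | p , p<n , hᵖgx≡rx = exit-hits p<n (subst (T ∘ U) (sym hᵖgx≡rx) (U-r-closed Ux))

  g′-first-entry : ∀ {x j} → T (U x) → Avoids (g x) j → T (U (h^ j (g x))) → g′ x ≡ h^ j (g x)
  g′-first-entry {x} Ux avoids Uhʲgx with exit-spec n (g x)
  ... | j′ , g′x≡ , avoids′ =
    trans g′x≡ (cong (λ i → h^ i (g x))
                     (least-unique avoids′ (subst (T ∘ U) g′x≡ (g′-∈U Ux)) avoids Uhʲgx))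

  Reach-exit : ∀ k y → Reach y (exit k y)
  Reach-exit zero    y = ε
  Reach-exit (suc k) y with U y
  ... | true  = ε
  ... | false = h-path ◅◅ Reach-exit k (h y)

  Reach′⇒Reach : ∀ {u w} → T (U u) → Reach′ u w → Reach u w × T (U w)
  Reach′⇒Reach Uu ε = ε , Uu
  Reach′⇒Reach {u} Uu (here refl ◅ p) with Reach′⇒Reach (g′-∈U Uu) p
  ... | q , Uw = (here refl ◅ Reach-exit n (g u)) ◅◅ q , Uw
  Reach′⇒Reach Uu (there (here refl) ◅ p) with Reach′⇒Reach (U-r-closed Uu) p
  ... | q , Uw = there (here refl) ◅ q , Uw

  -- A g–r-walk from a vertex of U is always either at a vertex u′ of U reached by g′ and r, or on the path
  -- leaving u′ along g, which stays outside U until it reaches g′ u′.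
  Segment : Fin n → Fin n → Set
  Segment u′ w = ∃ λ m → Avoids (g u′) (suc m) × (w ≡ h^ m (g u′) ⊎ w ≡ r (h^ m (g u′)))

  Trace : Fin n → Fin n → Set
  Trace u w = ∃ λ u′ → T (U u′) × Reach′ u u′ × (w ≡ u′ ⊎ Segment u′ w)

  Trace-r : ∀ {u w} → Trace u w → Trace u (r w)
  Trace-r (u′ , Uu′ , u~u′ , inj₁ refl) =
    r u′ , U-r-closed Uu′ , u~u′ ◅◅ (there (here refl) ◅ ε) , inj₁ refl
  Trace-r (u′ , Uu′ , u~u′ , inj₂ (m , avoids , inj₁ refl)) =
    u′ , Uu′ , u~u′ , inj₂ (m , avoids , inj₂ refl)
  Trace-r (u′ , Uu′ , u~u′ , inj₂ (m , avoids , inj₂ refl)) =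
    u′ , Uu′ , u~u′ , inj₂ (m , avoids , inj₁ (r-invol _))

  Trace-g : ∀ {u w} → Trace u w → Trace u (g w)
  Trace-g (u′ , Uu′ , u~u′ , inj₁ refl) with T? (U (g u′))
  ... | yes Ugu′ = g u′ , Ugu′ , u~u′ ◅◅ (here (exit-fixed n Ugu′) ◅ ε) , inj₁ refl
  ... | no ¬Ugu′ = u′ , Uu′ , u~u′ , inj₂ (0 , Avoids-suc (λ ()) ¬Ugu′ , inj₁ refl)
  Trace-g (u′ , Uu′ , u~u′ , inj₂ (zero , _ , inj₁ refl)) = u′ , Uu′ , u~u′ , inj₁ (g-invol u′)
  Trace-g (u′ , Uu′ , u~u′ , inj₂ (suc m , avoids , inj₁ refl)) =
    u′ , Uu′ , u~u′ , inj₂ (m , Avoids-pred avoids , inj₂ (g-invol _))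
  Trace-g (u′ , Uu′ , u~u′ , inj₂ (m , avoids , inj₂ refl)) with T? (U (h^ (suc m) (g u′)))
  ... | yes U-next = _ , U-next , u~u′ ◅◅ (here (g′-first-entry Uu′ avoids U-next) ◅ ε) , inj₁ refl
  ... | no ¬U-next = u′ , Uu′ , u~u′ , inj₂ (suc m , Avoids-suc avoids ¬U-next , inj₁ refl)

  Reach⇒Trace : ∀ {u w} → Reach u w → T (U u) → Trace u w
  Reach⇒Trace = foldl (λ u w → T (U u) → Trace u w) extend (λ Uu → _ , Uu , ε , inj₁ refl)
    where
    extend : ∀ {u v w} → (T (U u) → Trace u v) → Step gr v w → T (U u) → Trace u w
    extend trace (here refl)         = Trace-g ∘ trace
    extend trace (there (here refl)) = Trace-r ∘ trace

  Reach⇒Reach′ : ∀ {u w} → T (U u) → Reach u w → T (U w) → Reach′ u w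
  Reach⇒Reach′ Uu u~w Uw with Reach⇒Trace u~w Uu
  ... | _ , _ , u~′u′ , inj₁ refl                   = u~′u′
  ... | _ , _ , _     , inj₂ (m , avoids , inj₁ refl) = contradiction Uw (avoids (n<1+n m))
  ... | _ , _ , _     , inj₂ (m , avoids , inj₂ refl) = contradiction Uw (¬U-r (avoids (n<1+n m)))

  Reach′⇔Reach∩U : ∀ {u w} → T (U u) → Reach′ u w ⇔ (Reach u w × T (U w))
  Reach′⇔Reach∩U Uu = mk⇔ (Reach′⇒Reach Uu) (λ (u~w , Uw) → Reach⇒Reach′ Uu u~w Uw)

brClosed⇒r-closed : ∀ H {U : VSet (Gehm.n H)} → T (brClosed H U) → ∀ {w} → T (U w) → T (U (Gehm.r H w))
brClosed⇒r-closed H {U} closed Uw = proj₂ (to T-∧ (to (T-⊆ᵇ U (λ w → U (b w) ∧ U (r w))) closed Uw))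
  where open Gehm H

vA≡vH : ∀ H (U : VSet (Gehm.n H)) → T (brClosed H U) → Restrict.vA H U ≡ vH H
vA≡vH H U closed = begin
  nOrbitsOn g′r U + isolates + newIsolates  ≡⟨ xy∙z≈xz∙y (nOrbitsOn g′r U) isolates newIsolates ⟩
  nOrbitsOn g′r U + newIsolates + isolates  ≡⟨ cong (_+ isolates) restricted-count ⟩
  nOrbitsOn gr full + isolates              ∎
  where
  open Gehm H
  open Restrict H U using (newIsolates)
  open Deletion H U (brClosed⇒r-closed H {U} closed)
  open ≡-Reasoning
  restricted-count : nOrbitsOn g′r U + newIsolates ≡ nOrbitsOn gr full
  restricted-count = nOrbitsOn-restrict gr g′r (g-invol ∷ r-invol ∷ []) U Reach′⇔Reach∩U

module Powers {c ℓ : Level} (R : CommutativeRing c ℓ) where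

  open import Data.Integer using (-[1+_]; _⊖_)

  open CommutativeRing R hiding (_+_; zero) renaming (refl to ≈-refl; sym to ≈-sym; trans to ≈-trans)
  open import Algebra.Properties.CommutativeSemiring.Exp commutativeSemiring
    using (_^_; ^-homo-*; ^-distrib-*; ^-congˡ)
  open import Algebra.Properties.CommutativeSemigroup *-commutativeSemigroup using (interchange)
  open import Relation.Binary.Reasoning.Setoid setoid

  pow≡^ : ∀ a k → pow R a k ≡ a ^ k
  pow≡^ a zero    = refl
  pow≡^ a (suc k) = cong (a *_) (pow≡^ a k)

  pow-+ : ∀ a m k → pow R a (m ℕ.+ k) ≈ pow R a m * pow R a k
  pow-+ a m k rewrite pow≡^ a (m ℕ.+ k) | pow≡^ a m | pow≡^ a k = ^-homo-* a m k

  pow-* : ∀ a b k → pow R (a * b) k ≈ pow R a k * pow R b k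
  pow-* a b k rewrite pow≡^ (a * b) k | pow≡^ a k | pow≡^ b k = ^-distrib-* a b k

  pow-cong : ∀ {a b} k → a ≈ b → pow R a k ≈ pow R b k
  pow-cong {a} {b} k a≈b rewrite pow≡^ a k | pow≡^ b k = ^-congˡ k a≈b

  module _ {a a⁻ : Carrier} (a-inv : a * a⁻ ≈ 1#) where

    zpow-⊖ : ∀ p q → zpow R a a⁻ (p ⊖ q) ≈ pow R a p * pow R a⁻ q
    zpow-⊖ p       zero    = ≈-sym (*-identityʳ _)
    zpow-⊖ zero    (suc q) = ≈-sym (*-identityˡ _)
    zpow-⊖ (suc p) (suc q) = begin
      zpow R a a⁻ (suc p ⊖ suc q)              ≡⟨ cong (zpow R a a⁻) ([1+m]⊖[1+n]≡m⊖n p q) ⟩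
      zpow R a a⁻ (p ⊖ q)                      ≈⟨ zpow-⊖ p q ⟩
      pow R a p * pow R a⁻ q                   ≈⟨ *-identityˡ _ ⟨
      1# * (pow R a p * pow R a⁻ q)            ≈⟨ *-congʳ a-inv ⟨
      (a * a⁻) * (pow R a p * pow R a⁻ q)      ≈⟨ interchange a a⁻ _ _ ⟩
      pow R a (suc p) * pow R a⁻ (suc q)       ∎

    zpow-+ : ∀ i j → zpow R a a⁻ (i ℤ.+ j) ≈ zpow R a a⁻ i * zpow R a a⁻ j
    zpow-+ (+ m)    (+ n)    = pow-+ a m n
    zpow-+ (+ m)    -[1+ n ] = zpow-⊖ m (suc n)
    zpow-+ -[1+ m ] (+ n)    = ≈-trans (zpow-⊖ n (suc m)) (*-comm _ _)
    zpow-+ -[1+ m ] -[1+ n ] = begin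
      pow R a⁻ (suc (suc (m ℕ.+ n)))          ≡⟨ cong (λ k → pow R a⁻ (suc k)) (+-suc m n) ⟨
      pow R a⁻ (suc m ℕ.+ suc n)              ≈⟨ pow-+ a⁻ (suc m) (suc n) ⟩
      pow R a⁻ (suc m) * pow R a⁻ (suc n)     ∎

  zpow-neg : ∀ a a⁻ i → zpow R a⁻ a i ≡ zpow R a a⁻ (ℤ.- i)
  zpow-neg a a⁻ (+ zero)  = refl
  zpow-neg a a⁻ (+ suc k) = refl
  zpow-neg a a⁻ -[1+ k ]  = refl

  zpow-* : ∀ a a⁻ b b⁻ i → zpow R (a * b) (a⁻ * b⁻) i ≈ zpow R a a⁻ i * zpow R b b⁻ i
  zpow-* a a⁻ b b⁻ (+ k)    = pow-* a b k
  zpow-* a a⁻ b b⁻ -[1+ k ] = pow-* a⁻ b⁻ (suc k)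

  zpow-cong : ∀ {a a′ a⁻ a⁻′} → a ≈ a′ → a⁻ ≈ a⁻′ → ∀ i → zpow R a a⁻ i ≈ zpow R a′ a⁻′ i
  zpow-cong a≈a′ _     (+ k)    = pow-cong k a≈a′
  zpow-cong _    a⁻≈a⁻′ -[1+ k ] = pow-cong (suc k) a⁻≈a⁻′


module Sums {c ℓ : Level} (R : CommutativeRing c ℓ) where

  open CommutativeRing R hiding (_+_; zero) renaming (refl to ≈-refl; trans to ≈-trans)

  ΣR-cong-∈ : ∀ {A : Set} {f f′ : A → Carrier} {xs} → (∀ {x} → x ∈ xs → f x ≈ f′ x) →
              ΣR R (map f xs) ≈ ΣR R (map f′ xs)
  ΣR-cong-∈ {xs = []}     _    = ≈-refl
  ΣR-cong-∈ {xs = x ∷ xs} f≈f′ = +-cong (f≈f′ (here refl)) (ΣR-cong-∈ (f≈f′ ∘ there))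

  *-distribˡ-ΣR : ∀ {A : Set} k (f : A → Carrier) xs → k * ΣR R (map f xs) ≈ ΣR R (map (λ x → k * f x) xs)
  *-distribˡ-ΣR k f []       = zeroʳ k
  *-distribˡ-ΣR k f (x ∷ xs) = ≈-trans (distribˡ k _ _) (+-cong ≈-refl (*-distribˡ-ΣR k f xs))

twice-ρ : ∀ v k e d f → + (2 ℕ.* v) ℤ.- + (2 ℕ.* k) ℤ.+ (+ (2 ℕ.* k) ℤ.- + v ℤ.- + e ℤ.+ + d ℤ.- + f)
                        ≡ + v ℤ.- + e ℤ.+ + d ℤ.- + f
twice-ρ v k e d f rewrite pos-* 2 v | pos-* 2 k = k-cancels (+ v) (+ k) (+ e) (+ d) (+ f)
  where
  k-cancels : ∀ V K E D F → + 2 ℤ.* V ℤ.- + 2 ℤ.* K ℤ.+ (+ 2 ℤ.* K ℤ.- V ℤ.- E ℤ.+ D ℤ.- F)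
                            ≡ V ℤ.- E ℤ.+ D ℤ.- F
  k-cancels = solve-∀

√x-exponent : ∀ V E D F EA DA FA → (V ℤ.- E ℤ.+ D ℤ.- F) ℤ.- (V ℤ.- EA ℤ.+ DA ℤ.- FA)
                                   ≡ (D ℤ.- E ℤ.- F) ℤ.+ (ℤ.- (DA ℤ.- EA) ℤ.+ FA)
√x-exponent = solve-∀

√y-exponent : ∀ V EA DA FA → + 2 ℤ.* (DA ℤ.- EA) ℤ.- (V ℤ.- EA ℤ.+ DA ℤ.- FA)
                             ≡ ℤ.- V ℤ.+ ((DA ℤ.- EA) ℤ.+ FA)
√y-exponent = solve-∀

module _ {c ℓ : Level} (R : CommutativeRing c ℓ) (H : Gehm) where

  open CommutativeRing R hiding (_+_; zero) renaming (refl to ≈-refl; sym to ≈-sym; trans to ≈-trans)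
  open import Algebra.Properties.CommutativeSemigroup *-commutativeSemigroup using (interchange)
  open import Relation.Binary.Reasoning.Setoid setoid
  open Powers R
  open Gehm H using (n)

  module Terms (s s⁻ t t⁻ : Carrier) (s-inv : s * s⁻ ≈ 1#) (t-inv : t * t⁻ ≈ 1#) where

    -- s = √x and t = √y, so monomial i j = √x ^ i * √y ^ j.
    monomial : ℤ → ℤ → Carrier
    monomial i j = zpow R s s⁻ i * zpow R t t⁻ j

    monomial-* : ∀ i j i′ j′ → monomial i j * monomial i′ j′ ≈ monomial (i ℤ.+ i′) (j ℤ.+ j′)
    monomial-* i j i′ j′ =
      ≈-trans (interchange _ _ _ _) (≈-sym (*-cong (zpow-+ s-inv i i′) (zpow-+ t-inv j j′)))

    zpow-t/s : ∀ i → zpow R (t * s⁻) (s * t⁻) i ≈ monomial (ℤ.- i) i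
    zpow-t/s i = begin
      zpow R (t * s⁻) (s * t⁻) i        ≈⟨ zpow-cong ≈-refl (*-comm s t⁻) i ⟩
      zpow R (t * s⁻) (t⁻ * s) i        ≈⟨ zpow-* t t⁻ s⁻ s i ⟩
      zpow R t t⁻ i * zpow R s⁻ s i     ≡⟨ cong (zpow R t t⁻ i *_) (zpow-neg s s⁻ i) ⟩
      zpow R t t⁻ i * zpow R s s⁻ (ℤ.- i) ≈⟨ *-comm _ _ ⟩
      monomial (ℤ.- i) i                ∎

    prefactor : Carrier
    prefactor = monomial (+ dH H ℤ.- + eH H ℤ.- + fH H) (ℤ.- (+ vH H))

    T-term Z-term : VSet n → Carrier
    T-term U = monomial (ρ₂H H ℤ.- ρ₂A) ((+ 2) ℤ.* (+ dA ℤ.- + eA) ℤ.- ρ₂A)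
      where open Restrict H U
    Z-term U = zpow R (t * s⁻) (s * t⁻) (+ dA ℤ.- + eA) * pow R (s * t) fA
      where open Restrict H U

    T-term≈prefactor*Z-term : ∀ U → T (brClosed H U) → T-term U ≈ prefactor * Z-term U
    T-term≈prefactor*Z-term U closed = begin
      T-term U                                                 ≡⟨ cong₂ monomial √x √y ⟩
      monomial (X ℤ.+ (ℤ.- D ℤ.+ F)) (ℤ.- V ℤ.+ (D ℤ.+ F))     ≈⟨ monomial-* X (ℤ.- V) _ _ ⟨
      prefactor * monomial (ℤ.- D ℤ.+ F) (D ℤ.+ F)            ≈⟨ *-congˡ (monomial-* (ℤ.- D) D F F) ⟨
      prefactor * (monomial (ℤ.- D) D * monomial F F)
        ≈⟨ *-congˡ (*-cong (zpow-t/s D) (zpow-* s s⁻ t t⁻ F)) ⟨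
      prefactor * Z-term U                                     ∎
      where
      open Restrict H U
      V = + vH H
      X = + dH H ℤ.- + eH H ℤ.- + fH H
      D = + dA ℤ.- + eA
      F = + fA
      ρ₂A≡ : ρ₂A ≡ V ℤ.- + eA ℤ.+ + dA ℤ.- + fA
      ρ₂A≡ = trans (twice-ρ vA kA eA dA fA)
                   (cong (λ v → + v ℤ.- + eA ℤ.+ + dA ℤ.- + fA) (vA≡vH H U closed))
      √x : ρ₂H H ℤ.- ρ₂A ≡ X ℤ.+ (ℤ.- D ℤ.+ F)
      √x = trans (cong₂ ℤ._-_ (twice-ρ (vH H) (kH H) (eH H) (dH H) (fH H)) ρ₂A≡)
                 (√x-exponent V (+ eH H) (+ dH H) (+ fH H) (+ eA) (+ dA) F)
      √y : (+ 2) ℤ.* D ℤ.- ρ₂A ≡ ℤ.- V ℤ.+ (D ℤ.+ F)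
      √y = trans (cong (λ e → (+ 2) ℤ.* D ℤ.- e) ρ₂A≡) (√y-exponent V (+ eA) (+ dA) F)

proposition4 : ∀ {c ℓ : Level} (R : CommutativeRing c ℓ) (H : Gehm)
    → let open CommutativeRing R in
      (s s⁻ t t⁻ : Carrier) → s * s⁻ ≈ 1# → t * t⁻ ≈ 1#
    → Tshift R H s s⁻ t t⁻
      ≈ (zpow R s s⁻ (+ dH H ℤ.- + eH H ℤ.- + fH H)
         * zpow R t t⁻ (ℤ.- (+ vH H)))
        * Zpoly R H (t * s⁻) (s * t⁻) (s * t)
proposition4 R H s s⁻ t t⁻ s-inv t-inv = begin
  Tshift R H s s⁻ t t⁻                                          ≈⟨ ΣR-cong-∈ term≈ ⟩
  ΣR R (map (λ U → prefactor * Z-term U) (hyperedgeSubsets H))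
    ≈⟨ *-distribˡ-ΣR prefactor Z-term (hyperedgeSubsets H) ⟨
  prefactor * Zpoly R H (t * s⁻) (s * t⁻) (s * t)               ∎
  where
  open CommutativeRing R using (_≈_; _*_; setoid)
  open import Relation.Binary.Reasoning.Setoid setoid
  open Sums R using (ΣR-cong-∈; *-distribˡ-ΣR)
  open Terms R H s s⁻ t t⁻ s-inv t-inv
  term≈ : ∀ {U} → U ∈ hyperedgeSubsets H → T-term U ≈ prefactor * Z-term U
  term≈ {U} U∈ = T-term≈prefactor*Z-term U (proj₂ (∈-filter⁻ (T? ∘ brClosed H) {xs = allSubsets _} U∈))
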